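{- Let $I=\langle G,l,f,\omega\rangle$ be an instance as described in the context, let $R_1=\{r_1,\dots,r_k\}\subseteq V$ and let $M\ge 0$. Run Algorithm $A_{bb}(I,R_1,M)$, and let $\ell_1,\dots,\ell_J$ be the phases (indices $i$) in which it adds a new node to its output set. Then $T_{\ell_i}\cap T_{\ell_j}=\emptyset$ for all $1\le i,j\le J$ with $i\neq j$.
   Context: $G=(V,E)$ is a graph with vertex set $V=\{1,\dots,n\}$ and positive edge lengths $l(e)$; $d(u,v)$ is the shortest-path distance in $G$. Each node $v$ has an opening cost $f(v)\ge 0$ and a demand $\omega(v)\ge 0$. Algorithm $A_{bb}(I,R_1,M)$: set $R\gets\emptyset$; for $i=1,\dots,k$ (in this order): let $S_i=\{v\in V:\omega(r_i)d(v,r_i)\le 2M\}\setminus\{r_i\}$; if $S_i\cap(R_1\cup R)=\emptyset$, add to $R$ a node $v\in S_i$ of minimum opening cost $f(v)$ (if $S_i$ is empty, nothing is added). Return $R$. For each $i$, $T_i=\{v\in V:\omega(r_i)d(v,r_i)\le M\}\setminus\{r_i\}$.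
   Formalization: The edge lengths $l(e)$, opening costs $f(v)$, demands $\omega(v)$ and the bound $M$ are rational, so the distances $d(u,v)$ are rational too. -}

module Defs where

open import Data.Nat using (ℕ)
open import Data.Fin using (Fin; _<_)
open import Data.Maybe using (Maybe; just; nothing)
open import Data.Product using (_×_; _,_; ∃-syntax; Σ-syntax)
open import Data.Sum using (_⊎_)
open import Data.List using (List)
open import Data.List.Membership.Propositional using (_∈_)
open import Data.Rational using (ℚ; 0ℚ; 1ℚ; _+_; _*_; _≤_)
open import Relation.Binary.PropositionalEquality using (_≡_; _≢_)
open import Relation.Nullary using (¬_)

-- An undirected edge {u,v} of length l, stored as (u , v , l).
Edge : ℕ → Set
Edge n = Fin n × Fin n × ℚ

data Walk {n : ℕ} (E : List (Edge n)) : Fin n → Fin n → ℚ → Set where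
  nil  : ∀ {u} → Walk E u u 0ℚ
  cons : ∀ {u w v l x} → ((u , w , l) ∈ E ⊎ (w , u , l) ∈ E) →
         Walk E w v x → Walk E u v (l + x)

IsShortestPathDist : {n : ℕ} → List (Edge n) → (Fin n → Fin n → ℚ) → Set
IsShortestPathDist {n} E d =
  (u v : Fin n) → (Walk E u v (d u v)) × (∀ x → Walk E u v x → d u v ≤ x)

2ℚ : ℚ
2ℚ = 1ℚ + 1ℚ

module Abb {n k : ℕ} (d : Fin n → Fin n → ℚ) (f ω : Fin n → ℚ)
           (r : Fin k → Fin n) (M : ℚ) where

  S : Fin k → Fin n → Set
  S i v = (ω (r i) * d v (r i) ≤ 2ℚ * M) × (v ≢ r i)

  T : Fin k → Fin n → Set
  T i v = (ω (r i) * d v (r i) ≤ M) × (v ≢ r i)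

  InR₁ : Fin n → Set
  InR₁ v = ∃[ j ] r j ≡ v

  -- An execution records, for each phase i, the node added (or nothing).
  -- The set R at the start of phase i: nodes added in earlier phases.
  InRBefore : (Fin k → Maybe (Fin n)) → Fin k → Fin n → Set
  InRBefore added i v = ∃[ j ] (j < i × added j ≡ just v)

  DisjointAt : (Fin k → Maybe (Fin n)) → Fin k → Set
  DisjointAt added i = ∀ v → S i v → ¬ (InR₁ v ⊎ InRBefore added i v)

  SEmpty : Fin k → Set
  SEmpty i = ∀ v → ¬ S i v

  -- Phase i is executed according to A_bb (ties in the minimum-cost
  -- choice may be broken arbitrarily).
  ValidPhase : (Fin k → Maybe (Fin n)) → Fin k → Set
  ValidPhase added i =
      (DisjointAt added i × ∃[ v ] (added i ≡ just v × S i v × (∀ w → S i w → f v ≤ f w)))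
    ⊎ ((¬ DisjointAt added i ⊎ SEmpty i) × added i ≡ nothing)

  IsExecution : (Fin k → Maybe (Fin n)) → Set
  IsExecution added = ∀ i → ValidPhase added i

module Submission where

-- Suppose phases i ≠ j both add a node and some v lies in
-- T_i ∩ T_j; by symmetry ω(r_j) ≤ ω(r_i).  By the triangle inequality
-- through v,
--   ω(r_j) d(r_i,r_j) ≤ ω(r_j) d(v,r_i) + ω(r_j) d(v,r_j)
--                     ≤ ω(r_i) d(v,r_i) + ω(r_j) d(v,r_j) ≤ 2M,
-- so r_i ∈ S_j (r_i ≠ r_j since r is injective).  But r_i ∈ R₁, and phase j
-- only adds a node when S_j misses R₁ — a contradiction.

open import Defs
open import Data.Nat using (ℕ)
open import Data.Fin using (Fin)
open import Data.Maybe using (Maybe; just)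
open import Data.Product using (_×_; ∃-syntax; proj₁; proj₂; _,_)
open import Data.Sum using (_⊎_; inj₁; inj₂; [_,_])
open import Data.List using (List)
open import Data.List.Membership.Propositional using (_∈_)
open import Data.List.Relation.Unary.All using (All)
import Data.List.Relation.Unary.All as All
open import Data.Rational using (ℚ; 0ℚ; 1ℚ; _≤_; _<_; _+_; _*_; nonNegative)
open import Data.Rational.Properties
open import Data.Empty using (⊥)
open import Relation.Binary.PropositionalEquality
  using (_≡_; _≢_; refl; sym; trans; cong; cong₂; subst)
open import Relation.Nullary using (¬_)
open import Function.Definitions using (Injective)

module Walks {n : ℕ} (E : List (Edge n)) where

  flip-edge : ∀ {u w l} → ((u , w , l) ∈ E ⊎ (w , u , l) ∈ E) →
              ((w , u , l) ∈ E ⊎ (u , w , l) ∈ E)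
  flip-edge (inj₁ e) = inj₂ e
  flip-edge (inj₂ e) = inj₁ e

  _++ʷ_ : ∀ {u w v x y} → Walk E u w x → Walk E w v y → Walk E u v (x + y)
  _++ʷ_ {y = y} nil q = subst (Walk E _ _) (sym (+-identityˡ y)) q
  _++ʷ_ {y = y} (cons {l = l} {x = x} e p) q =
    subst (Walk E _ _) (sym (+-assoc l x y)) (cons e (p ++ʷ q))

  reverseʷ : ∀ {u v x} → Walk E u v x → Walk E v u x
  reverseʷ nil = nil
  reverseʷ (cons {l = l} {x = x} e p) =
    subst (Walk E _ _) (trans (cong (x +_) (+-identityʳ l)) (+-comm x l))
      (reverseʷ p ++ʷ cons (flip-edge e) nil)

  walk-nonneg : All (λ e → 0ℚ < proj₂ (proj₂ e)) E →
                ∀ {u v x} → Walk E u v x → 0ℚ ≤ x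
  walk-nonneg pos nil = ≤-refl
  walk-nonneg pos (cons (inj₁ e) p) = +-mono-≤ (<⇒≤ (All.lookup pos e)) (walk-nonneg pos p)
  walk-nonneg pos (cons (inj₂ e) p) = +-mono-≤ (<⇒≤ (All.lookup pos e)) (walk-nonneg pos p)

  module Distance (d : Fin n → Fin n → ℚ) (sp : IsShortestPathDist E d) where

    dist-nonneg : All (λ e → 0ℚ < proj₂ (proj₂ e)) E → ∀ u v → 0ℚ ≤ d u v
    dist-nonneg pos u v = walk-nonneg pos (proj₁ (sp u v))

    -- Triangle inequality through a common source v: the reversed shortest
    -- walk v→u followed by the shortest walk v→w is a walk u→w.
    dist-via : ∀ v u w → d u w ≤ d v u + d v w
    dist-via v u w = proj₂ (sp u w) _ (reverseʷ (proj₁ (sp v u)) ++ʷ proj₁ (sp v w))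

double : ∀ M → 2ℚ * M ≡ M + M
double M = trans (*-distribʳ-+ M 1ℚ 1ℚ) (cong₂ _+_ (*-identityˡ M) (*-identityˡ M))

weighted-triangle : ∀ {wᵢ wⱼ dᵢ dⱼ dᵢⱼ M : ℚ} →
  wⱼ ≤ wᵢ → 0ℚ ≤ wⱼ → 0ℚ ≤ dᵢ → dᵢⱼ ≤ dᵢ + dⱼ →
  wᵢ * dᵢ ≤ M → wⱼ * dⱼ ≤ M → wⱼ * dᵢⱼ ≤ 2ℚ * M
weighted-triangle {wᵢ} {wⱼ} {dᵢ} {dⱼ} {dᵢⱼ} {M} wⱼ≤wᵢ wⱼ≥0 dᵢ≥0 tri hᵢ hⱼ = begin
  wⱼ * dᵢⱼ         ≤⟨ *-monoˡ-≤-nonNeg wⱼ {{nonNegative wⱼ≥0}} tri ⟩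
  wⱼ * (dᵢ + dⱼ)   ≡⟨ *-distribˡ-+ wⱼ dᵢ dⱼ ⟩
  wⱼ * dᵢ + wⱼ * dⱼ ≤⟨ +-monoˡ-≤ (wⱼ * dⱼ) (*-monoʳ-≤-nonNeg dᵢ {{nonNegative dᵢ≥0}} wⱼ≤wᵢ) ⟩
  wᵢ * dᵢ + wⱼ * dⱼ ≤⟨ +-mono-≤ hᵢ hⱼ ⟩
  M + M            ≡⟨ double M ⟨
  2ℚ * M           ∎
  where open ≤-Reasoning

module Phases {n k : ℕ} (d : Fin n → Fin n → ℚ) (f ω : Fin n → ℚ)
              (r : Fin k → Fin n) (M : ℚ)
              (added : Fin k → Maybe (Fin n))
              (exec : Abb.IsExecution d f ω r M added) where
  open Abb d f ω r M

  adding⇒disjoint : ∀ {j b} → added j ≡ just b → DisjointAt added j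
  adding⇒disjoint {j} bj with exec j
  ... | inj₁ (disj , _) = disj
  ... | inj₂ (_ , nothingⱼ) with trans (sym bj) nothingⱼ
  ...   | ()

  adding⇒centre∉S : ∀ {j b} → added j ≡ just b → ∀ i → ¬ S j (r i)
  adding⇒centre∉S bj i rᵢ∈Sⱼ = adding⇒disjoint bj (r i) rᵢ∈Sⱼ (inj₁ (i , refl))

-- The asymmetric core of the lemma: if v is within weighted radius M of
-- both centres and ω(r_j) ≤ ω(r_i), then r_i ∈ S_j, which is impossible
-- when phase j adds a node.
lighter-centre-excludes :
    ∀ {n k} (E : List (Edge n)) → All (λ e → 0ℚ < proj₂ (proj₂ e)) E →
    (d : Fin n → Fin n → ℚ) → IsShortestPathDist E d →
    (f ω : Fin n → ℚ) → (∀ v → 0ℚ ≤ ω v) →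
    (r : Fin k → Fin n) → Injective _≡_ _≡_ r → (M : ℚ) →
    (added : Fin k → Maybe (Fin n)) → Abb.IsExecution d f ω r M added →
    ∀ {i j b} v → i ≢ j → added j ≡ just b →
    ω (r i) * d v (r i) ≤ M → ω (r j) * d v (r j) ≤ M →
    ω (r j) ≤ ω (r i) → ⊥
lighter-centre-excludes E pos d sp f ω ω≥0 r inj M added exec {i} {j} v i≢j bⱼ hᵢ hⱼ ωⱼ≤ωᵢ =
  adding⇒centre∉S bⱼ i (close , λ eq → i≢j (inj eq))
  where
  open Walks.Distance E d sp
  open Phases d f ω r M added exec

  close : ω (r j) * d (r i) (r j) ≤ 2ℚ * M
  close = weighted-triangle ωⱼ≤ωᵢ (ω≥0 (r j)) (dist-nonneg pos v (r i))
            (dist-via v (r i) (r j)) hᵢ hⱼ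

lemma2p1 : (n : ℕ) (E : List (Edge n)) →
    All (λ e → 0ℚ < proj₂ (proj₂ e)) E →
    (d : Fin n → Fin n → ℚ) → IsShortestPathDist E d →
    (f ω : Fin n → ℚ) → (∀ v → 0ℚ ≤ f v) → (∀ v → 0ℚ ≤ ω v) →
    (k : ℕ) (r : Fin k → Fin n) → Injective _≡_ _≡_ r →
    (M : ℚ) → 0ℚ ≤ M →
    (added : Fin k → Maybe (Fin n)) → Abb.IsExecution d f ω r M added →
    (i j : Fin k) → i ≢ j → (∃[ a ] added i ≡ just a) → (∃[ b ] added j ≡ just b) →
    (v : Fin n) → ¬ (Abb.T d f ω r M i v × Abb.T d f ω r M j v)
lemma2p1 n E pos d sp f ω _ ω≥0 k r inj M _ added exec i j i≢j (_ , aᵢ) (_ , bⱼ) v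
         ((vTᵢ , _) , (vTⱼ , _)) =
  [ (λ ωⱼ≤ωᵢ → excludes v i≢j bⱼ vTᵢ vTⱼ ωⱼ≤ωᵢ)
  , (λ ωᵢ≤ωⱼ → excludes v (λ eq → i≢j (sym eq)) aᵢ vTⱼ vTᵢ ωᵢ≤ωⱼ)
  ] (≤-total (ω (r j)) (ω (r i)))
  where
  excludes : ∀ {i j b} v → i ≢ j → added j ≡ just b →
    ω (r i) * d v (r i) ≤ M → ω (r j) * d v (r j) ≤ M → ω (r j) ≤ ω (r i) → ⊥
  excludes = lighter-centre-excludes E pos d sp f ω ω≥0 r inj M added exec
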